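{- Let $n,k\in\mathbb{N}$ with $n\ge k\ge 2$, and let $P$ be a $k$-uniform tight path on $n$ vertices. Let $\alpha\in\mathbb{R}$ with $1\le\alpha\le k$, and let $W\subseteq V(P)$ be a vertex set such that $|e\cap W|\ge\alpha$ for every edge $e\in E(P)$. Then $$|W|\ge\frac{\alpha(n-k+1)}{k}.$$ Moreover, if $|e\cap W|>\frac{k+1}{2}$ for every edge $e\in E(P)$ and $n>\frac{k^2+k-2}{2}$, then $|W|>\frac{n}{2}$.
   Context: A $k$-uniform tight path on $n$ vertices ($k\ge2$, $n\ge k$) is a $k$-uniform hypergraph $P$ on $n$ vertices for which there is an ordering $v_1,\dots,v_n$ of its vertices such that its edge set $E(P)$ consists exactly of the sets $\{v_j,v_{j+1},\dots,v_{j+k-1}\}$ for $1\le j\le n-k+1$.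
   Formalization: The parameter α ranges over the rationals instead of the reals. -}

module Defs where

open import Data.Nat using (ℕ; _≤ᵇ_; _<ᵇ_; _+_; _≤_)
open import Data.Bool using (_∧_)
open import Data.Fin using (Fin; toℕ)
open import Data.Fin.Subset using (Subset)
open import Data.Vec using (tabulate)
open import Data.Product using (Σ; ∃; _×_)
open import Function.Bundles using (_↔_; Inverse; _⇔_)
open import Relation.Binary.PropositionalEquality using (_≡_)
open import Data.Integer using (+_)
open import Data.Rational using (ℚ; _/_)

Hypergraph : ℕ → Set₁
Hypergraph n = Subset n → Set

-- Given an ordering σ : position ↔ vertex (v_{i+1} = σ i, 0-based positions),
-- the window starting at 0-based position j is {v_{j+1}, …, v_{j+k}}:
-- vertex v belongs to it iff j ≤ pos(v) < j + k.
window : {n : ℕ} → (k : ℕ) → Fin n ↔ Fin n → ℕ → Subset n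
window k σ j = tabulate λ v →
  (j ≤ᵇ toℕ (Inverse.from σ v)) ∧ (toℕ (Inverse.from σ v) <ᵇ j + k)

-- E is a k-uniform tight path on n vertices: there is an ordering of the
-- vertices such that the edges are exactly the k consecutive windows
-- (0-based start j with j + k ≤ n, i.e. 1 ≤ j+1 ≤ n-k+1).
IsTightPath : (n k : ℕ) → Hypergraph n → Set
IsTightPath n k E =
  Σ (Fin n ↔ Fin n) λ σ →
    ∀ (e : Subset n) → E e ⇔ (∃ λ j → (j + k ≤ n) × (e ≡ window k σ j))

⟦_⟧ : ℕ → ℚ
⟦ m ⟧ = + m / 1

-- Summing ∣e ∩ W∣ over the n - k + 1 edges counts each vertex of W at most k
-- times, so α (n - k + 1) ≤ k ∣W∣.  For the second bound only the q = ⌊n/k⌋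
-- pairwise disjoint edges starting at positions 0, k, …, (q - 1) k are used:
-- each contains at least (k + 2)/2 vertices of W, so 2 ∣W∣ ≥ q (k + 2).  With
-- n = q k + r and r < k this exceeds n unless 2 q ≤ r, and then
-- 2 n ≤ r (k + 2) ≤ (k - 1)(k + 2) = k² + k - 2.

module Submission where

open import Defs
open import Data.Nat using (ℕ; _≤_; _<_; _+_; _*_; _∸_)
open import Data.Fin.Subset using (Subset; _∩_; ∣_∣)
open import Data.Product using (_×_; _,_)
import Data.Rational as Q
import Data.Rational.Properties as Q
import Data.Rational.Unnormalised as Qᵘ
import Data.Rational.Unnormalised.Properties as Qᵘ
import Data.Integer as ℤ
import Data.Integer.Properties as ℤ
open import Data.Nat using (zero; suc; s≤s⁻¹; s≤s; z≤n; _⊓_; _≤ᵇ_; _<ᵇ_; NonZero; >-nonZero; _/_; _%_)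
open import Data.Nat.Properties
open import Data.Nat.DivMod using (m≡m%n+[m/n]*n; m%n<n; m/n*n≤m)
open import Data.Nat.Tactic.RingSolver using (solve-∀)
open import Data.Bool using (Bool; true; false; _∧_)
open import Data.Bool.Properties using (T-≡)
open import Data.Fin using (Fin; toℕ) renaming (zero to fzero; suc to fsuc)
open import Data.Fin.Properties using (toℕ<n)
open import Data.Vec using (_∷_; []; lookup)
open import Data.Vec.Properties using (lookup∘tabulate; lookup-zipWith)
open import Function.Bundles using (_↔_; Inverse; Equivalence)
open import Relation.Binary.PropositionalEquality
open import Relation.Nullary using (contradiction)
open import Relation.Nullary.Reflects using (ofʸ; ofⁿ)
open import Algebra.Properties.Semiring.Sum +-*-semiring
  using (sum-syntax; sum-cong-≗; ∑-comm; sum-replicate-zero; *-distribˡ-sum; *-distribʳ-sum)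

𝟙 : Bool → ℕ
𝟙 true  = 1
𝟙 false = 0

𝟙-∧ : ∀ a b → 𝟙 (a ∧ b) ≡ 𝟙 a * 𝟙 b
𝟙-∧ true  b = sym (+-identityʳ (𝟙 b))
𝟙-∧ false b = refl

𝟙≤1 : ∀ b → 𝟙 b ≤ 1
𝟙≤1 true  = ≤-refl
𝟙≤1 false = z≤n

∑-mono-≤ : ∀ {m} {f g : Fin m → ℕ} → (∀ i → f i ≤ g i) → ∑[ i < m ] f i ≤ ∑[ i < m ] g i
∑-mono-≤ {zero}  f≤g = z≤n
∑-mono-≤ {suc m} f≤g = +-mono-≤ (f≤g fzero) (∑-mono-≤ (λ i → f≤g (fsuc i)))

∑-const : ∀ m c → ∑[ i < m ] c ≡ m * c
∑-const zero    c = refl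
∑-const (suc m) c = cong (c +_) (∑-const m c)

∑-telescope : ∀ (h g : ℕ → ℕ) → (∀ i → h i + g i ≡ g (suc i)) →
              ∀ m → ∑[ i < m ] h (toℕ i) + g 0 ≡ g m
∑-telescope h g step zero    = refl
∑-telescope h g step (suc m) = begin
  (h 0 + ∑h′) + g 0  ≡⟨ cong (_+ g 0) (+-comm (h 0) ∑h′) ⟩
  (∑h′ + h 0) + g 0  ≡⟨ +-assoc ∑h′ (h 0) (g 0) ⟩
  ∑h′ + (h 0 + g 0)  ≡⟨ cong (∑h′ +_) (step 0) ⟩
  ∑h′ + g 1          ≡⟨ ∑-telescope (λ i → h (suc i)) (λ i → g (suc i)) (λ i → step (suc i)) m ⟩
  g (suc m)          ∎
  where
  open ≡-Reasoning
  ∑h′ : ℕ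
  ∑h′ = ∑[ i < m ] h (suc (toℕ i))

χ : ∀ {n} → Subset n → Fin n → ℕ
χ S v = 𝟙 (lookup S v)

∣∣≡∑χ : ∀ {n} (S : Subset n) → ∣ S ∣ ≡ ∑[ v < n ] χ S v
∣∣≡∑χ []          = refl
∣∣≡∑χ (true ∷ S)  = cong suc (∣∣≡∑χ S)
∣∣≡∑χ (false ∷ S) = ∣∣≡∑χ S

∣∩∣≡∑χ*χ : ∀ {n} (S W : Subset n) → ∣ S ∩ W ∣ ≡ ∑[ v < n ] (χ S v * χ W v)
∣∩∣≡∑χ*χ S W = trans (∣∣≡∑χ (S ∩ W)) (sum-cong-≗ λ v →
  trans (cong 𝟙 (lookup-zipWith _∧_ v S W)) (𝟙-∧ (lookup S v) (lookup W v)))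

degree : ∀ {m n} → (Fin m → Subset n) → Fin n → ℕ
degree {m} S v = ∑[ i < m ] χ (S i) v

∑∣∩∣≤*∣∣ : ∀ {m n} (S : Fin m → Subset n) (W : Subset n) M →
           (∀ v → degree S v ≤ M) → ∑[ i < m ] ∣ S i ∩ W ∣ ≤ M * ∣ W ∣
∑∣∩∣≤*∣∣ {m} {n} S W M degree≤M = begin
  ∑[ i < m ] ∣ S i ∩ W ∣
    ≡⟨ sum-cong-≗ (λ i → ∣∩∣≡∑χ*χ (S i) W) ⟩
  ∑[ i < m ] ∑[ v < n ] (χ (S i) v * χ W v)
    ≡⟨ ∑-comm (λ i v → χ (S i) v * χ W v) ⟩
  ∑[ v < n ] ∑[ i < m ] (χ (S i) v * χ W v)
    ≡⟨ sum-cong-≗ (λ v → *-distribʳ-sum (χ W v) (λ i → χ (S i) v)) ⟨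
  ∑[ v < n ] (degree S v * χ W v)
    ≤⟨ ∑-mono-≤ (λ v → *-monoˡ-≤ (χ W v) (degree≤M v)) ⟩
  ∑[ v < n ] (M * χ W v)
    ≡⟨ *-distribˡ-sum M (χ W) ⟨
  M * ∑[ v < n ] χ W v
    ≡⟨ cong (M *_) (∣∣≡∑χ W) ⟨
  M * ∣ W ∣ ∎
  where open ≤-Reasoning

inWindow : ℕ → ℕ → ℕ → Bool
inWindow k j p = (j ≤ᵇ p) ∧ (p <ᵇ j + k)

position : ∀ {n} → Fin n ↔ Fin n → Fin n → ℕ
position σ v = toℕ (Inverse.from σ v)

lookup-window : ∀ {n} k (σ : Fin n ↔ Fin n) j v →
                lookup (window k σ j) v ≡ inWindow k j (position σ v)
lookup-window k σ j v = lookup∘tabulate (λ v → inWindow k j (position σ v)) v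

inWindow-suc : ∀ k j p → inWindow k (suc j) (suc p) ≡ inWindow k j p
inWindow-suc k zero    p = refl
inWindow-suc k (suc j) p = refl

𝟙[<ᵇ]+⊓≤⊓suc : ∀ k q → 𝟙 (q <ᵇ k) + k ⊓ q ≤ k ⊓ suc q
𝟙[<ᵇ]+⊓≤⊓suc k q with q <ᵇ k | <ᵇ-reflects-< q k
... | true  | ofʸ q<k = subst (suc (k ⊓ q) ≤_) (sym (m≥n⇒m⊓n≡n q<k)) (s≤s (m⊓n≤n k q))
... | false | ofⁿ _   = ⊓-monoʳ-≤ k (n≤1+n q)

-- The bound k alone is not preserved by the induction; k ⊓ (p + 1) is.
∑-inWindow≤ : ∀ k m p → ∑[ j < m ] 𝟙 (inWindow k (toℕ j) p) ≤ k ⊓ suc p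
∑-inWindow≤ k zero    p       = z≤n
∑-inWindow≤ k (suc m) zero    = begin
  𝟙 (0 <ᵇ k) + ∑[ j < m ] 0   ≡⟨ cong (𝟙 (0 <ᵇ k) +_) (sum-replicate-zero m) ⟩
  𝟙 (0 <ᵇ k) + 0              ≤⟨ +-monoʳ-≤ (𝟙 (0 <ᵇ k)) z≤n ⟩
  𝟙 (0 <ᵇ k) + k ⊓ 0          ≤⟨ 𝟙[<ᵇ]+⊓≤⊓suc k 0 ⟩
  k ⊓ 1                       ∎
  where open ≤-Reasoning
∑-inWindow≤ k (suc m) (suc p) = begin
  𝟙 (suc p <ᵇ k) + ∑[ j < m ] 𝟙 (inWindow k (suc (toℕ j)) (suc p))
    ≡⟨ cong (𝟙 (suc p <ᵇ k) +_) (sum-cong-≗ {m} λ j → cong 𝟙 (inWindow-suc k (toℕ j) p)) ⟩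
  𝟙 (suc p <ᵇ k) + ∑[ j < m ] 𝟙 (inWindow k (toℕ j) p)
    ≤⟨ +-monoʳ-≤ (𝟙 (suc p <ᵇ k)) (∑-inWindow≤ k m p) ⟩
  𝟙 (suc p <ᵇ k) + k ⊓ suc p
    ≤⟨ 𝟙[<ᵇ]+⊓≤⊓suc k (suc p) ⟩
  k ⊓ suc (suc p) ∎
  where open ≤-Reasoning

𝟙-inWindow+𝟙-<ᵇ : ∀ k j p → 𝟙 (inWindow k j p) + 𝟙 (p <ᵇ j) ≡ 𝟙 (p <ᵇ j + k)
𝟙-inWindow+𝟙-<ᵇ k j p with j ≤ᵇ p | ≤ᵇ-reflects-≤ j p | p <ᵇ j | <ᵇ-reflects-< p j
... | true  | ofʸ j≤p | true  | ofʸ p<j = contradiction j≤p (<⇒≱ p<j)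
... | true  | _       | false | _       = +-identityʳ _
... | false | ofⁿ j≰p | false | ofⁿ p≮j = contradiction (≮⇒≥ p≮j) j≰p
... | false | _       | true  | ofʸ p<j =
  cong 𝟙 (sym (Equivalence.to T-≡ (<⇒<ᵇ (<-≤-trans p<j (m≤m+n j k)))))

∑-inWindow-disjoint : ∀ k q p → ∑[ b < q ] 𝟙 (inWindow k (toℕ b * k) p) ≡ 𝟙 (p <ᵇ q * k)
∑-inWindow-disjoint k q p = trans (sym (+-identityʳ _)) (∑-telescope h g h+g≡g∘suc q)
  where
  h g : ℕ → ℕ
  h b = 𝟙 (inWindow k (b * k) p)
  g b = 𝟙 (p <ᵇ b * k)
  h+g≡g∘suc : ∀ b → h b + g b ≡ g (suc b)
  h+g≡g∘suc b = trans (𝟙-inWindow+𝟙-<ᵇ k (b * k) p)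
                      (cong (λ c → 𝟙 (p <ᵇ c)) (+-comm (b * k) k))

∑∣window∩∣≤*∣∣ : ∀ {m n} k (σ : Fin n ↔ Fin n) (start : Fin m → ℕ) (W : Subset n) M →
                 (∀ p → ∑[ i < m ] 𝟙 (inWindow k (start i) p) ≤ M) →
                 ∑[ i < m ] ∣ window k σ (start i) ∩ W ∣ ≤ M * ∣ W ∣
∑∣window∩∣≤*∣∣ {m} k σ start W M cover = ∑∣∩∣≤*∣∣ (λ i → window k σ (start i)) W M λ v →
  subst (_≤ M) (sum-cong-≗ {m} λ i → cong 𝟙 (sym (lookup-window k σ (start i) v)))
    (cover (position σ v))

∑∣window∩∣≤k*∣∣ : ∀ {n} k (σ : Fin n ↔ Fin n) m (W : Subset n) →
                  ∑[ j < m ] ∣ window k σ (toℕ j) ∩ W ∣ ≤ k * ∣ W ∣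
∑∣window∩∣≤k*∣∣ k σ m W = ∑∣window∩∣≤*∣∣ {m} k σ toℕ W k λ p →
  ≤-trans (∑-inWindow≤ k m p) (m⊓n≤m k (suc p))

∑∣disjointWindow∩∣≤∣∣ : ∀ {n} k (σ : Fin n ↔ Fin n) q (W : Subset n) →
                        ∑[ b < q ] ∣ window k σ (toℕ b * k) ∩ W ∣ ≤ ∣ W ∣
∑∣disjointWindow∩∣≤∣∣ k σ q W =
  subst (∑[ b < q ] ∣ window k σ (toℕ b * k) ∩ W ∣ ≤_) (*-identityˡ ∣ W ∣)
    (∑∣window∩∣≤*∣∣ {q} k σ (λ b → toℕ b * k) W 1 λ p →
      subst (_≤ 1) (sym (∑-inWindow-disjoint k q p)) (𝟙≤1 (p <ᵇ q * k)))

n<n/k*[k+2] : ∀ n k .{{_ : NonZero k}} → k * k + k ∸ 2 < 2 * n → n < n / k * (k + 2)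
n<n/k*[k+2] n k@(suc k-1) k²+k∸2<2n = begin-strict
  n                  ≡⟨ m≡m%n+[m/n]*n n k ⟩
  r + q * k          <⟨ +-monoˡ-< (q * k) r<2q ⟩
  2 * q + q * k      ≡⟨ 2a+ab≡a[b+2] q k ⟩
  q * (k + 2)        ∎
  where
  open ≤-Reasoning
  q r : ℕ
  q = n / k
  r = n % k
  2a+ab≡a[b+2] : ∀ a b → 2 * a + a * b ≡ a * (b + 2)
  2a+ab≡a[b+2] = solve-∀
  2[a+bc]≡2a+2bc : ∀ a b c → 2 * (a + b * c) ≡ 2 * a + 2 * b * c
  2[a+bc]≡2a+2bc = solve-∀
  [1+a]²+[1+a]≡a[a+3]+2 : ∀ a → suc a * suc a + suc a ≡ a * (suc a + 2) + 2
  [1+a]²+[1+a]≡a[a+3]+2 = solve-∀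
  2q≤r⇒2n≤k²+k∸2 : 2 * q ≤ r → 2 * n ≤ k * k + k ∸ 2
  2q≤r⇒2n≤k²+k∸2 2q≤r = begin
    2 * n              ≡⟨ cong (2 *_) (m≡m%n+[m/n]*n n k) ⟩
    2 * (r + q * k)    ≡⟨ 2[a+bc]≡2a+2bc r q k ⟩
    2 * r + 2 * q * k  ≤⟨ +-monoʳ-≤ (2 * r) (*-monoˡ-≤ k 2q≤r) ⟩
    2 * r + r * k      ≡⟨ 2a+ab≡a[b+2] r k ⟩
    r * (k + 2)        ≤⟨ *-monoˡ-≤ (k + 2) (s≤s⁻¹ (m%n<n n k)) ⟩
    k-1 * (k + 2)      ≡⟨ m+n∸n≡m (k-1 * (k + 2)) 2 ⟨
    k-1 * (k + 2) + 2 ∸ 2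
                       ≡⟨ cong (_∸ 2) ([1+a]²+[1+a]≡a[a+3]+2 k-1) ⟨
    k * k + k ∸ 2      ∎
  r<2q : r < 2 * q
  r<2q = ≰⇒> λ 2q≤r → <⇒≱ k²+k∸2<2n (2q≤r⇒2n≤k²+k∸2 2q≤r)

toℚᵘ-⟦⟧ : ∀ m → Q.toℚᵘ ⟦ m ⟧ Qᵘ.≃ Qᵘ.mkℚᵘ (ℤ.+ m) 0
toℚᵘ-⟦⟧ m = Q.toℚᵘ-fromℚᵘ (Qᵘ.mkℚᵘ (ℤ.+ m) 0)

⟦⟧-homo-+ : ∀ a b → ⟦ a + b ⟧ ≡ ⟦ a ⟧ Q.+ ⟦ b ⟧
⟦⟧-homo-+ a b = Q.toℚᵘ-injective (begin
  Q.toℚᵘ ⟦ a + b ⟧                          ≈⟨ toℚᵘ-⟦⟧ (a + b) ⟩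
  Qᵘ.mkℚᵘ (ℤ.+ (a + b)) 0                   ≈⟨ Qᵘ.*≡* (cong (ℤ._* ℤ.+ 1) +[a+b]≡+a*1++b*1) ⟩
  Qᵘ.mkℚᵘ (ℤ.+ a) 0 Qᵘ.+ Qᵘ.mkℚᵘ (ℤ.+ b) 0  ≈⟨ Qᵘ.+-cong (toℚᵘ-⟦⟧ a) (toℚᵘ-⟦⟧ b) ⟨
  Q.toℚᵘ ⟦ a ⟧ Qᵘ.+ Q.toℚᵘ ⟦ b ⟧            ≈⟨ Q.toℚᵘ-homo-+ ⟦ a ⟧ ⟦ b ⟧ ⟨
  Q.toℚᵘ (⟦ a ⟧ Q.+ ⟦ b ⟧)                  ∎)
  where
  open Qᵘ.≃-Reasoning
  +[a+b]≡+a*1++b*1 : ℤ.+ (a + b) ≡ ℤ.+ a ℤ.* ℤ.+ 1 ℤ.+ ℤ.+ b ℤ.* ℤ.+ 1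
  +[a+b]≡+a*1++b*1 = trans (ℤ.pos-+ a b)
    (sym (cong₂ ℤ._+_ (ℤ.*-identityʳ (ℤ.+ a)) (ℤ.*-identityʳ (ℤ.+ b))))

⟦⟧-homo-* : ∀ a b → ⟦ a * b ⟧ ≡ ⟦ a ⟧ Q.* ⟦ b ⟧
⟦⟧-homo-* a b = Q.toℚᵘ-injective (begin
  Q.toℚᵘ ⟦ a * b ⟧                          ≈⟨ toℚᵘ-⟦⟧ (a * b) ⟩
  Qᵘ.mkℚᵘ (ℤ.+ (a * b)) 0                   ≈⟨ Qᵘ.*≡* (cong (ℤ._* ℤ.+ 1) (ℤ.pos-* a b)) ⟩
  Qᵘ.mkℚᵘ (ℤ.+ a) 0 Qᵘ.* Qᵘ.mkℚᵘ (ℤ.+ b) 0  ≈⟨ Qᵘ.*-cong (toℚᵘ-⟦⟧ a) (toℚᵘ-⟦⟧ b) ⟨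
  Q.toℚᵘ ⟦ a ⟧ Qᵘ.* Q.toℚᵘ ⟦ b ⟧            ≈⟨ Q.toℚᵘ-homo-* ⟦ a ⟧ ⟦ b ⟧ ⟨
  Q.toℚᵘ (⟦ a ⟧ Q.* ⟦ b ⟧)                  ∎)
  where open Qᵘ.≃-Reasoning

⟦⟧-mono-≤ : ∀ {a b} → a ≤ b → ⟦ a ⟧ Q.≤ ⟦ b ⟧
⟦⟧-mono-≤ {a} {b} a≤b = Q.toℚᵘ-cancel-≤ (Qᵘ.≤-respˡ-≃ (Qᵘ.≃-sym (toℚᵘ-⟦⟧ a))
  (Qᵘ.≤-respʳ-≃ (Qᵘ.≃-sym (toℚᵘ-⟦⟧ b)) (Qᵘ.*≤* (ℤ.*-monoʳ-≤-nonNeg (ℤ.+ 1) (ℤ.+≤+ a≤b)))))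

*⟦⟧≤⟦∑⟧ : ∀ (α : Q.ℚ) {m} (f : Fin m → ℕ) → (∀ i → α Q.≤ ⟦ f i ⟧) →
          α Q.* ⟦ m ⟧ Q.≤ ⟦ ∑[ i < m ] f i ⟧
*⟦⟧≤⟦∑⟧ α {zero}  f α≤f = Q.≤-reflexive (Q.*-zeroʳ α)
*⟦⟧≤⟦∑⟧ α {suc m} f α≤f = begin
  α Q.* ⟦ suc m ⟧                      ≡⟨ cong (α Q.*_) (⟦⟧-homo-+ 1 m) ⟩
  α Q.* (⟦ 1 ⟧ Q.+ ⟦ m ⟧)              ≡⟨ Q.*-distribˡ-+ α ⟦ 1 ⟧ ⟦ m ⟧ ⟩
  α Q.* ⟦ 1 ⟧ Q.+ α Q.* ⟦ m ⟧          ≡⟨ cong (Q._+ α Q.* ⟦ m ⟧) (Q.*-identityʳ α) ⟩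
  α Q.+ α Q.* ⟦ m ⟧                    ≤⟨ Q.+-mono-≤ (α≤f fzero) (*⟦⟧≤⟦∑⟧ α f′ (λ i → α≤f (fsuc i))) ⟩
  ⟦ f fzero ⟧ Q.+ ⟦ ∑[ i < m ] f′ i ⟧  ≡⟨ ⟦⟧-homo-+ (f fzero) (∑[ i < m ] f′ i) ⟨
  ⟦ ∑[ i < suc m ] f i ⟧               ∎
  where
  open Q.≤-Reasoning
  f′ : Fin m → ℕ
  f′ i = f (fsuc i)

window-fits : ∀ {n} k → k ≤ n → (j : Fin (n ∸ k + 1)) → toℕ j + k ≤ n
window-fits {n} k k≤n j = m≤o∸n⇒m+n≤o (toℕ j) k≤n
  (m<1+n⇒m≤n (subst (toℕ j <_) (+-comm (n ∸ k) 1) (toℕ<n j)))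

disjointWindow-fits : ∀ n k .{{_ : NonZero k}} (b : Fin (n / k)) → toℕ b * k + k ≤ n
disjointWindow-fits n k b = begin
  toℕ b * k + k    ≡⟨ +-comm (toℕ b * k) k ⟩
  suc (toℕ b) * k  ≤⟨ *-monoˡ-≤ k (toℕ<n b) ⟩
  n / k * k        ≤⟨ m/n*n≤m n k ⟩
  n                ∎
  where open ≤-Reasoning

∣W∣-lowerBound : ∀ {n} k (σ : Fin n ↔ Fin n) (W : Subset n) (α : Q.ℚ) → k ≤ n →
                 (∀ j → j + k ≤ n → α Q.≤ ⟦ ∣ window k σ j ∩ W ∣ ⟧) →
                 α Q.* ⟦ n ∸ k + 1 ⟧ Q.≤ ⟦ k ⟧ Q.* ⟦ ∣ W ∣ ⟧
∣W∣-lowerBound {n} k σ W α k≤n α≤hits = begin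
  α Q.* ⟦ m ⟧            ≤⟨ *⟦⟧≤⟦∑⟧ α hits (λ j → α≤hits (toℕ j) (window-fits k k≤n j)) ⟩
  ⟦ ∑[ j < m ] hits j ⟧  ≤⟨ ⟦⟧-mono-≤ (∑∣window∩∣≤k*∣∣ k σ m W) ⟩
  ⟦ k * ∣ W ∣ ⟧          ≡⟨ ⟦⟧-homo-* k ∣ W ∣ ⟩
  ⟦ k ⟧ Q.* ⟦ ∣ W ∣ ⟧    ∎
  where
  open Q.≤-Reasoning
  m : ℕ
  m = n ∸ k + 1
  hits : Fin m → ℕ
  hits j = ∣ window k σ (toℕ j) ∩ W ∣

∣W∣-majority : ∀ {n} k .{{_ : NonZero k}} (σ : Fin n ↔ Fin n) (W : Subset n) →
               (∀ j → j + k ≤ n → k + 1 < 2 * ∣ window k σ j ∩ W ∣) →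
               k * k + k ∸ 2 < 2 * n → n < 2 * ∣ W ∣
∣W∣-majority {n} k σ W k+1<2hits k²+k∸2<2n = begin-strict
  n                       <⟨ n<n/k*[k+2] n k k²+k∸2<2n ⟩
  q * (k + 2)             ≡⟨ ∑-const q (k + 2) ⟨
  ∑[ b < q ] (k + 2)      ≤⟨ ∑-mono-≤ {q} k+2≤2hits ⟩
  ∑[ b < q ] (2 * hits b) ≡⟨ *-distribˡ-sum {q} 2 hits ⟨
  2 * ∑[ b < q ] hits b   ≤⟨ *-monoʳ-≤ 2 (∑∣disjointWindow∩∣≤∣∣ k σ q W) ⟩
  2 * ∣ W ∣               ∎
  where
  open ≤-Reasoning
  q : ℕ
  q = n / k
  hits : Fin q → ℕ
  hits b = ∣ window k σ (toℕ b * k) ∩ W ∣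
  k+2≤2hits : ∀ b → k + 2 ≤ 2 * hits b
  k+2≤2hits b = subst (_≤ 2 * hits b) (sym (+-suc k 1))
    (k+1<2hits (toℕ b * k) (disjointWindow-fits n k b))

proposition1 : (n k : ℕ) → 2 ≤ k → k ≤ n →
    (E : Hypergraph n) → IsTightPath n k E →
    (W : Subset n) →
      ((α : Q.ℚ) → ⟦ 1 ⟧ Q.≤ α → α Q.≤ ⟦ k ⟧ →
        (∀ e → E e → α Q.≤ ⟦ ∣ e ∩ W ∣ ⟧) →
        α Q.* ⟦ n ∸ k + 1 ⟧ Q.≤ ⟦ k ⟧ Q.* ⟦ ∣ W ∣ ⟧)
      ×
      ((∀ e → E e → k + 1 < 2 * ∣ e ∩ W ∣) →
        k * k + k ∸ 2 < 2 * n →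
        n < 2 * ∣ W ∣)
proposition1 n k 2≤k k≤n E (σ , E⇔window) W =
  (λ α _ _ α≤∣e∩W∣ → ∣W∣-lowerBound k σ W α k≤n (λ j fits → α≤∣e∩W∣ _ (window-isEdge j fits))) ,
  (λ k+1<2∣e∩W∣ → ∣W∣-majority k σ W (λ j fits → k+1<2∣e∩W∣ _ (window-isEdge j fits)))
  where
  instance
    k≢0 : NonZero k
    k≢0 = >-nonZero (≤-trans (s≤s z≤n) 2≤k)
  window-isEdge : ∀ j → j + k ≤ n → E (window k σ j)
  window-isEdge j fits = Equivalence.from (E⇔window (window k σ j)) (j , fits , refl)
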